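{- For every connected graph $G$, $\operatorname{tcw}(G)\leq \operatorname{lfen}(G)+1$ and $\operatorname{lfen}(G)\leq \operatorname{fen}(G)$.
   Context: All graphs are finite, simple and undirected. For a connected graph $G=(V,E)$, the feedback edge number $\operatorname{fen}(G)$ is the minimum cardinality of a set $F\subseteq E$ such that $G-F$ is acyclic. For a spanning tree $T$ of $G$ and $v\in V$, the local feedback edge set at $v$ is $E_{\operatorname{loc}}^T(v)=\{uw\in E\setminus E(T) : \text{the unique path between } u \text{ and } w \text{ in } T \text{ contains } v\}$. Then $\operatorname{lfen}(G,T)=\max_{v\in V}|E_{\operatorname{loc}}^T(v)|$ and the local feedback edge number is $\operatorname{lfen}(G)=\min_{T}\operatorname{lfen}(G,T)$, the minimum over all spanning trees $T$ of $G$. $\operatorname{tcw}(G)$ denotes the treecut width of $G$ (in the standard sense of Wollan / Marx–Wollan, defined via treecut decompositions, adhesions and torso sizes). -}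

module Defs where

open import Data.Nat using (ℕ; zero; suc; _+_; _≤_)
open import Data.Bool using (Bool; true; false; not; _∧_; if_then_else_)
open import Data.Bool.Properties using () renaming (_≟_ to _≟B_)
open import Data.Fin using (Fin; toℕ)
open import Data.Fin.Properties using () renaming (_≟_ to _≟F_)
open import Data.Nat.Properties using () renaming (_<?_ to _<ℕ?_)
open import Data.Nat using () renaming (_<_ to _<ℕ_)
open import Data.Sum using (_⊎_; inj₁; inj₂)
open import Data.Sum.Properties using (≡-dec)
open import Data.Product using (Σ; _×_; _,_; proj₁; proj₂; ∃)
open import Data.List using (List; []; _∷_; _++_; length; map; filter; concatMap; allFin)
open import Data.Nat.ListAction using (sum)
open import Data.List.Membership.Propositional using (_∈_; _∉_)
open import Data.List.Relation.Unary.All using (All)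
open import Data.List.Relation.Unary.Unique.Propositional using (Unique)
open import Data.List.Relation.Binary.Permutation.Propositional using (_↭_)
open import Data.Unit using (⊤)
open import Data.Empty using (⊥)
open import Relation.Nullary using (¬_; Dec; yes; no; ¬?)
open import Relation.Nullary.Decidable using (isYes)
open import Relation.Binary.Definitions using (DecidableEquality)
open import Relation.Binary.PropositionalEquality using (_≡_; _≢_)
open import Relation.Binary.Construct.Closure.ReflexiveTransitive using (Star)

record Graph (n : ℕ) : Set where
  field
    adj    : Fin n → Fin n → Bool
    sym    : ∀ u v → adj u v ≡ adj v u
    irrefl : ∀ v → adj v v ≡ false

open Graph public

E : ∀ {n} → Graph n → Fin n → Fin n → Set
E G u v = adj G u v ≡ true

data PathFrom {A : Set} (R : A → A → Set) : A → A → List A → Set where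
  here : ∀ {x} → PathFrom R x x (x ∷ [])
  step : ∀ {x y z vs} → R x y → PathFrom R y z vs → PathFrom R x z (x ∷ vs)

Path : {A : Set} → (A → A → Set) → A → A → List A → Set
Path R x z vs = PathFrom R x z vs × Unique vs

Connected : {A : Set} → (A → A → Set) → Set
Connected {A} R = ∀ (u w : A) → Σ (List A) λ vs → Path R u w vs

Acyclic : {A : Set} → (A → A → Set) → Set
Acyclic {A} R = ∀ (x y : A) (vs : List A) → Path R x y vs → 3 ≤ length vs → ¬ R y x

CardAtMost : {A : Set} → (A → Set) → ℕ → Set
CardAtMost {A} P k = Σ (List A) λ xs → (length xs ≤ k) × (∀ x → P x → x ∈ xs)

-- an edge {u,w} is represented by the ordered pair (u , w) with u < w
_<F_ : ∀ {n} → Fin n → Fin n → Set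
u <F w = toℕ u <ℕ toℕ w

record EdgeSubset {n : ℕ} (G : Graph n) : Set where
  field
    sel   : Fin n → Fin n → Bool
    ssym  : ∀ u v → sel u v ≡ sel v u
    sub   : ∀ u v → sel u v ≡ true → E G u v

open EdgeSubset public

InF : ∀ {n} {G : Graph n} → EdgeSubset G → Fin n → Fin n → Set
InF F u v = sel F u v ≡ true

EdgesOf : ∀ {n} {G : Graph n} → EdgeSubset G → Fin n × Fin n → Set
EdgesOf F (u , w) = (u <F w) × InF F u w

Minus : ∀ {n} (G : Graph n) → EdgeSubset G → Fin n → Fin n → Set
Minus G F u v = E G u v × (sel F u v ≡ false)

IsFeedbackEdgeSet : ∀ {n} (G : Graph n) → EdgeSubset G → Set
IsFeedbackEdgeSet G F = Acyclic (Minus G F)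

IsFen : ∀ {n} → Graph n → ℕ → Set
IsFen G k =
  (Σ (EdgeSubset G) λ F → IsFeedbackEdgeSet G F × CardAtMost (EdgesOf F) k)
  × (∀ (F : EdgeSubset G) (k' : ℕ) → IsFeedbackEdgeSet G F → CardAtMost (EdgesOf F) k' → k ≤ k')

IsSpanningTree : ∀ {n} (G : Graph n) → EdgeSubset G → Set
IsSpanningTree G T = Connected (InF T) × Acyclic (InF T)

Eloc : ∀ {n} (G : Graph n) → EdgeSubset G → Fin n → Fin n × Fin n → Set
Eloc {n} G T v (u , w) =
  (u <F w) × E G u w × (sel T u w ≡ false)
  × (Σ (List (Fin n)) λ ps → Path (InF T) u w ps × v ∈ ps)

LfenTAtMost : ∀ {n} (G : Graph n) → EdgeSubset G → ℕ → Set
LfenTAtMost G T k = ∀ v → CardAtMost (Eloc G T v) k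

IsLfen : ∀ {n} → Graph n → ℕ → Set
IsLfen G k =
  (Σ (EdgeSubset G) λ T → IsSpanningTree G T × LfenTAtMost G T k)
  × (∀ (T : EdgeSubset G) (k' : ℕ) → IsSpanningTree G T → LfenTAtMost G T k' → k ≤ k')

record MG (V : Set) : Set where
  constructor mg
  field
    verts : List V
    edges : List (V × V)

open MG public

module ThreeCenter {V : Set} (_≟V_ : DecidableEquality V) where

  removeV : V → List V → List V
  removeV x = filter (λ y → ¬? (y ≟V x))

  Incident : V × V → V → Set
  Incident e x = (proj₁ e ≡ x) ⊎ (proj₂ e ≡ x)

  NotIncident : List (V × V) → V → Set
  NotIncident es x = All (λ e → ¬ Incident e x) es

  Joins : V × V → V → V → Set
  Joins e x a = (e ≡ (x , a)) ⊎ (e ≡ (a , x))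

  ind : ∀ {P : Set} → Dec P → ℕ
  ind (yes _) = 1
  ind (no _)  = 0

  -- degree (a loop counts twice)
  deg : V → List (V × V) → ℕ
  deg x es = sum (map (λ e → ind (proj₁ e ≟V x) + ind (proj₂ e ≟V x)) es)

  data Step (X : V → Set) : MG V → MG V → Set where
    del0 : ∀ {vs es x} → x ∈ vs → ¬ X x → NotIncident es x →
           Step X (mg vs es) (mg (removeV x vs) es)
    del1 : ∀ {vs es rest x a e} → x ∈ vs → ¬ X x →
           es ↭ (e ∷ rest) → Joins e x a → a ≢ x → NotIncident rest x →
           Step X (mg vs es) (mg (removeV x vs) rest)
    delLoop : ∀ {vs es rest x} → x ∈ vs → ¬ X x →
           es ↭ ((x , x) ∷ rest) → NotIncident rest x →
           Step X (mg vs es) (mg (removeV x vs) rest)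
    suppress : ∀ {vs es rest x a b e₁ e₂} → x ∈ vs → ¬ X x →
           es ↭ (e₁ ∷ e₂ ∷ rest) → Joins e₁ x a → Joins e₂ x b →
           a ≢ x → b ≢ x → NotIncident rest x →
           Step X (mg vs es) (mg (removeV x vs) ((a , b) ∷ rest))

  Irreducible : (V → Set) → MG V → Set
  Irreducible X g = ∀ x → x ∈ verts g → ¬ X x → 3 ≤ deg x (edges g)

  ThreeCenterSize : (V → Set) → MG V → ℕ → Set
  ThreeCenterSize X g c =
    Σ (MG V) λ g' → Star (Step X) g g' × Irreducible X g' × (length (verts g') ≡ c)

record TCD {n : ℕ} (G : Graph n) : Set where
  field
    m         : ℕ
    tree      : Graph (suc m)
    connected : Connected (E tree)
    acyclic   : Acyclic (E tree)
    bag       : Fin n → Fin (suc m)  -- near-partition: v ∈ X_(bag v)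

open TCD public

module _ {n : ℕ} {G : Graph n} (D : TCD G) where

  Node : Set
  Node = Fin (suc (m D))

  -- s is a neighbour of t and node r lies in the component of T - t containing s
  Branch : Node → Node → Node → Set
  Branch t s r = E (tree D) t s × (Σ (List Node) λ ps → Path (E (tree D)) s r ps × t ∉ ps)

  Adh : Node → Node → Fin n × Fin n → Set
  Adh s t (u , w) = (u <F w) × E G u w ×
    ((Branch t s (bag D u) × Branch s t (bag D w)) ⊎ (Branch s t (bag D u) × Branch t s (bag D w)))

  TV : Set
  TV = Fin n ⊎ Node

  _≟TV_ : DecidableEquality TV
  _≟TV_ = ≡-dec _≟F_ _≟F_

  -- f maps each vertex of G to its image in the torso at t:
  -- itself if in X_t, else the vertex z_s for the component of T - t containing its node
  ImgSpec : Node → (Fin n → TV) → Set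
  ImgSpec t f = ∀ v → ((bag D v ≡ t) × (f v ≡ inj₁ v))
                    ⊎ ((bag D v ≢ t) × (Σ Node λ s → (f v ≡ inj₂ s) × Branch t s (bag D v)))

  -- the torso H_t (multigraph; loops deleted, parallel edges kept)
  Torso : Node → (Fin n → TV) → MG TV
  Torso t f = mg
    (map inj₁ (filter (λ v → bag D v ≟F t) (allFin n))
      ++ map inj₂ (filter (λ s → adj (tree D) t s ≟B true) (allFin (suc (m D)))))
    (concatMap (λ u → concatMap (λ w →
        if isYes (toℕ u <ℕ? toℕ w) ∧ adj G u w ∧ not (isYes (f u ≟TV f w))
        then (f u , f w) ∷ [] else []) (allFin n)) (allFin n))

  TorsoX : TV → Set
  TorsoX (inj₁ _) = ⊤
  TorsoX (inj₂ _) = ⊥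

  open ThreeCenter _≟TV_ using (ThreeCenterSize)

  WidthAtMost : ℕ → Set
  WidthAtMost w =
    (∀ s t → E (tree D) s t → CardAtMost (Adh s t) w)
    × (∀ t f → ImgSpec t f → ∀ c → ThreeCenterSize TorsoX (Torso t f) c → c ≤ w)

IsTcw : ∀ {n} → Graph n → ℕ → Set
IsTcw G k = (Σ (TCD G) λ D → WidthAtMost D k) × (∀ (D : TCD G) (w : ℕ) → WidthAtMost D w → k ≤ w)

module Submission where

-- Take a spanning tree T realising lfen(G) = l and use T itself as the decomposition tree,
-- with one vertex of G in each bag. An edge crossing the cut of a tree edge st is either st
-- or a non-tree edge whose tree path runs through s, so every adhesion has at most l + 1
-- edges. In the torso at t, each tree edge ts becomes a spoke from t to the vertex z_s that
-- contracts the branch of s, and every other torso edge comes from E_loc(t); hence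
-- |E| ≤ #branches + l. Each 3-center reduction deletes a branch vertex together with at
-- least one edge and never a spoke of another branch vertex, so this bound survives. At the
-- end every branch vertex has degree at least 3, while an edge contributes at most 2 to the
-- sum of their degrees and a spoke only 1; so 4k ≤ 2(k + l) for k branch vertices, and the
-- 3-center has at most k + 1 ≤ l + 1 vertices.
--
-- For lfen ≤ fen, extend the forest G − F greedily to a spanning tree T: every edge outside
-- T lies in F, so every local feedback edge set of T is contained in F.

open import Defs hiding (sym)

open import Data.Bool using (Bool; true; false; _∧_; _∨_; not; if_then_else_)
open import Data.Bool.Properties using (∨-zeroʳ; not-involutive; ¬-not) renaming (_≟_ to _≟B_)
open import Data.Empty using (⊥-elim)
open import Data.Fin using (Fin; toℕ)
open import Data.Fin.Properties using (toℕ-injective) renaming (_≟_ to _≟F_)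
open import Data.List using (List; []; _∷_; _++_; length; map; filter; concatMap; cartesianProduct; allFin)
open import Data.List.Properties
  using (length-++; length-map; map-++; filter-++; filter-all; filter-none; filter-accept; filter-reject)
open import Data.List.Membership.Propositional using (_∈_; _∉_; lose)
open import Data.List.Membership.Propositional.Properties
  using ( ∈-∃++; ∈-filter⁻; ∈-filter⁺; ∈-++⁻; ∈-++⁺ˡ; ∈-++⁺ʳ; ∈-map⁺; ∈-map⁻; ∈-concatMap⁺
        ; ∈-cartesianProduct⁺; ∈-allFin)
open import Data.List.Relation.Binary.Permutation.Propositional using (_↭_; ↭-refl)
open import Data.List.Relation.Binary.Permutation.Propositional.Properties using (∈-resp-↭; ↭-length)
open import Data.List.Relation.Binary.Subset.Propositional using (_⊆_)
open import Data.List.Relation.Unary.All using (All; []; _∷_)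
import Data.List.Relation.Unary.All as All
open import Data.List.Relation.Unary.All.Properties.Core using (¬Any⇒All¬)
open import Data.List.Relation.Unary.AllPairs using ([]; _∷_)
open import Data.List.Relation.Unary.Any using (here; there; any?; satisfied)
open import Data.List.Relation.Unary.Unique.Propositional using (Unique)
import Data.List.Relation.Unary.Unique.Propositional.Properties as UniqueP
import Data.List.Relation.Unary.Unique.DecPropositional
open import Data.Nat using (ℕ; zero; suc; _+_; _*_; _≤_; _<?_; z≤n; s≤s)
open import Data.Nat.Properties
  using ( ≤-reflexive; ≤-trans; <-asym; ≤∧≢⇒<; ≮⇒≥; +-suc; +-comm; +-identityʳ; +-commutativeSemigroup
        ; +-mono-≤; +-monoˡ-≤; +-cancelˡ-≤; *-distribʳ-+; *-monoˡ-≤; *-cancelʳ-≤; module ≤-Reasoning)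
open import Data.Nat.ListAction using (sum)
open import Data.Nat.Tactic.RingSolver using (solve-∀)
open import Data.Product using (Σ; _×_; _,_; proj₁; proj₂; uncurry)
open import Data.Sum using (_⊎_; inj₁; inj₂; [_,_]′; swap; map₂)
open import Data.Sum.Properties using (inj₁-injective; inj₂-injective)
open import Data.Unit using (⊤; tt)
open import Function using (_∘_; id; mk⇔)
open import Relation.Binary.Construct.Closure.ReflexiveTransitive using (Star; ε; _◅_)
open import Relation.Binary.Definitions using (DecidableEquality)
open import Relation.Binary.PropositionalEquality
  using (_≡_; _≢_; refl; sym; trans; cong; cong₂; subst; module ≡-Reasoning)
open import Relation.Nullary using (¬_; Dec; yes; no; ¬?)
open import Relation.Nullary.Decidable using (isYes; does; map′; _×-dec_; _⊎-dec_; dec-true; does-⇔)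
open import Relation.Unary using (Decidable)
open import Relation.Unary.Properties using (∁?)

-- Lists and sums

module _ {A B : Set} where

  length-≤-injection : (g : A → B) {xs : List A} {ys : List B} → Unique xs →
    (∀ {a b} → a ∈ xs → b ∈ xs → g a ≡ g b → a ≡ b) → (∀ {a} → a ∈ xs → g a ∈ ys) →
    length xs ≤ length ys
  length-≤-injection g {[]} _ _ _ = z≤n
  length-≤-injection g {a ∷ xs} (a∉xs ∷ uniq) inj into with ∈-∃++ (into (here refl))
  ... | ys₁ , ys₂ , refl = begin
    suc (length xs)               ≤⟨ s≤s (length-≤-injection g uniq (λ p q → inj (there p) (there q)) into′) ⟩
    suc (length (ys₁ ++ ys₂))     ≡⟨ cong suc (length-++ ys₁) ⟩
    suc (length ys₁ + length ys₂) ≡⟨ +-suc (length ys₁) (length ys₂) ⟨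
    length ys₁ + suc (length ys₂) ≡⟨ length-++ ys₁ ⟨
    length (ys₁ ++ g a ∷ ys₂)     ∎
    where
    open ≤-Reasoning
    into′ : ∀ {b} → b ∈ xs → g b ∈ ys₁ ++ ys₂
    into′ {b} b∈xs with ∈-++⁻ ys₁ (into (there b∈xs))
    ... | inj₁ p = ∈-++⁺ˡ p
    ... | inj₂ (here gb≡ga) = ⊥-elim (All.lookup a∉xs b∈xs (inj (here refl) (there b∈xs) (sym gb≡ga)))
    ... | inj₂ (there p) = ∈-++⁺ʳ ys₁ p

length-≤-⊆ : ∀ {A : Set} {xs ys : List A} → Unique xs → xs ⊆ ys → length xs ≤ length ys
length-≤-⊆ uniq xs⊆ys = length-≤-injection (λ x → x) uniq (λ _ _ eq → eq) xs⊆ys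

module _ {A : Set} where

  Unique-++⁻ : ∀ (xs : List A) {ys} → Unique (xs ++ ys) → Unique xs × Unique ys
  Unique-++⁻ [] uniq = [] , uniq
  Unique-++⁻ (x ∷ xs) (x∉ ∷ uniq) =
    All.tabulate (λ z∈xs → All.lookup x∉ (∈-++⁺ˡ z∈xs)) ∷ proj₁ (Unique-++⁻ xs uniq) , proj₂ (Unique-++⁻ xs uniq)

  Unique-++-disjoint : ∀ (xs : List A) {ys z} → Unique (xs ++ ys) → z ∈ xs → z ∉ ys
  Unique-++-disjoint (x ∷ xs) (x∉ ∷ _) (here refl) z∈ys = All.lookup x∉ (∈-++⁺ʳ xs z∈ys) refl
  Unique-++-disjoint (x ∷ xs) (_ ∷ uniq) (there z∈xs) = Unique-++-disjoint xs uniq z∈xs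

module _ {A : Set} {P : A → Set} (P? : Decidable P) where

  length-filter-∁ : ∀ xs → length (filter P? xs) + length (filter (∁? P?) xs) ≡ length xs
  length-filter-∁ [] = refl
  length-filter-∁ (x ∷ xs) with P? x
  ... | yes _ = cong suc (length-filter-∁ xs)
  ... | no _ = trans (+-suc _ _) (cong suc (length-filter-∁ xs))

module _ {A : Set} (_≟_ : DecidableEquality A) where

  open ThreeCenter _≟_ using (removeV; ind)

  sum-map-ind : ∀ {B : Set} {P : B → Set} (P? : Decidable P) xs →
    sum (map (λ x → ind (P? x)) xs) ≡ length (filter P? xs)
  sum-map-ind P? [] = refl
  sum-map-ind P? (x ∷ xs) with P? x
  ... | yes _ = cong suc (sum-map-ind P? xs)
  ... | no _ = sum-map-ind P? xs

  length-filter-≡-≤1 : ∀ y {xs} → Unique xs → length (filter (y ≟_) xs) ≤ 1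
  length-filter-≡-≤1 y {xs} uniq =
    length-≤-⊆ {ys = y ∷ []} (UniqueP.filter⁺ (y ≟_) uniq) (λ m → here (sym (proj₂ (∈-filter⁻ (y ≟_) {xs = xs} m))))

  length-filter-≡-∉ : ∀ {y xs} → y ∉ xs → length (filter (y ≟_) xs) ≡ 0
  length-filter-≡-∉ {y} {xs} y∉xs = cong length (filter-none (y ≟_) (¬Any⇒All¬ xs y∉xs))

  length-filter-removeV : ∀ {P : A → Set} (P? : Decidable P) {x vs} → Unique vs → x ∈ vs → P x →
    length (filter P? vs) ≡ suc (length (filter P? (removeV x vs)))
  length-filter-removeV P? {x} {_ ∷ vs} (x∉ ∷ _) (here refl) px
    rewrite filter-reject (λ y → ¬? (y ≟ x)) {x} {vs} (λ x≢x → x≢x refl)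
          | filter-all (λ y → ¬? (y ≟ x)) (All.map (λ x≢y y≡x → x≢y (sym y≡x)) x∉)
          | filter-accept P? {x} {vs} px = refl
  length-filter-removeV P? {x} {v ∷ vs} (v∉ ∷ uniq) (there x∈vs) px with v ≟ x
  ... | yes refl = ⊥-elim (All.lookup v∉ x∈vs refl)
  ... | no _ with P? v
  ...   | yes _ = cong suc (length-filter-removeV P? uniq x∈vs px)
  ...   | no _ = length-filter-removeV P? uniq x∈vs px

module _ {A : Set} where

  sum-map-+ : (f g : A → ℕ) (xs : List A) →
    sum (map (λ x → f x + g x) xs) ≡ sum (map f xs) + sum (map g xs)
  sum-map-+ f g [] = refl
  sum-map-+ f g (x ∷ xs) rewrite sum-map-+ f g xs = +-interchange (f x) (g x) _ _
    where open import Algebra.Properties.CommutativeSemigroup +-commutativeSemigroup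
            using () renaming (interchange to +-interchange)

  sum-map-swap : ∀ {B : Set} (F : A → B → ℕ) (xs : List A) (ys : List B) →
    sum (map (λ x → sum (map (F x) ys)) xs) ≡ sum (map (λ y → sum (map (λ x → F x y) xs)) ys)
  sum-map-swap F xs [] = sum-map-zero xs
    where
    sum-map-zero : ∀ (xs : List A) → sum (map (λ _ → 0) xs) ≡ 0
    sum-map-zero [] = refl
    sum-map-zero (_ ∷ xs) = sum-map-zero xs
  sum-map-swap F xs (y ∷ ys) =
    trans (sum-map-+ (λ x → F x y) (λ x → sum (map (F x) ys)) xs)
          (cong (sum (map (λ x → F x y) xs) +_) (sum-map-swap F xs ys))

  sum-map-≤ : (f g : A → ℕ) (xs : List A) → All (λ x → f x ≤ g x) xs →
    sum (map f xs) ≤ sum (map g xs)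
  sum-map-≤ f g [] [] = z≤n
  sum-map-≤ f g (x ∷ xs) (fx≤gx ∷ f≤g) = +-mono-≤ fx≤gx (sum-map-≤ f g xs f≤g)

  sum-map-const : (c : ℕ) (xs : List A) → sum (map (λ _ → c) xs) ≡ length xs * c
  sum-map-const c [] = refl
  sum-map-const c (_ ∷ xs) = cong (c +_) (sum-map-const c xs)

module _ {A B : Set} where

  concatMap-if≡map-filter : (c : A → A → Bool) (g : A → A → B) (us ws : List A) →
    concatMap (λ u → concatMap (λ w → if c u w then g u w ∷ [] else []) ws) us
    ≡ map (uncurry g) (filter (λ p → uncurry c p ≟B true) (cartesianProduct us ws))
  concatMap-if≡map-filter c g [] ws = refl
  concatMap-if≡map-filter c g (u ∷ us) ws = begin
    row ws ++ concatMap (λ u → concatMap (λ w → if c u w then g u w ∷ [] else []) ws) us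
      ≡⟨ cong₂ _++_ (row≡ ws) (concatMap-if≡map-filter c g us ws) ⟩
    map (uncurry g) (filter C? (map (u ,_) ws)) ++ map (uncurry g) (filter C? (cartesianProduct us ws))
      ≡⟨ map-++ (uncurry g) (filter C? (map (u ,_) ws)) (filter C? (cartesianProduct us ws)) ⟨
    map (uncurry g) (filter C? (map (u ,_) ws) ++ filter C? (cartesianProduct us ws))
      ≡⟨ cong (map (uncurry g)) (filter-++ C? (map (u ,_) ws) (cartesianProduct us ws)) ⟨
    map (uncurry g) (filter C? (map (u ,_) ws ++ cartesianProduct us ws)) ∎
    where
    open ≡-Reasoning
    C? : Decidable (λ p → uncurry c p ≡ true)
    C? p = uncurry c p ≟B true
    row : List A → List B
    row = concatMap (λ w → if c u w then g u w ∷ [] else [])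
    row≡ : ∀ ws → row ws ≡ map (uncurry g) (filter C? (map (u ,_) ws))
    row≡ [] = refl
    row≡ (w ∷ ws) with c u w
    ... | true = cong (g u w ∷_) (row≡ ws)
    ... | false = row≡ ws

m*3+m≤[m+n]*2⇒m≤n : ∀ m n → m * 3 + m ≤ (m + n) * 2 → m ≤ n
m*3+m≤[m+n]*2⇒m≤n m n le = *-cancelʳ-≤ m n 2 (+-cancelˡ-≤ (m * 2) _ _ (begin
  m * 2 + m * 2 ≡⟨ m*3+m≡m*2+m*2 m ⟨
  m * 3 + m     ≤⟨ le ⟩
  (m + n) * 2   ≡⟨ *-distribʳ-+ 2 m n ⟩
  m * 2 + n * 2 ∎))
  where
  open ≤-Reasoning
  m*3+m≡m*2+m*2 : ∀ m → m * 3 + m ≡ m * 2 + m * 2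
  m*3+m≡m*2+m*2 = solve-∀

sortedPair : ∀ {N} → Fin N → Fin N → Fin N × Fin N
sortedPair s t with toℕ s <? toℕ t
... | yes _ = s , t
... | no _ = t , s

sortedPair-unique : ∀ {N} {s t u w : Fin N} → s ≢ t → s ≡ u ⊎ s ≡ w → t ≡ u ⊎ t ≡ w →
  u <F w → (u , w) ≡ sortedPair s t
sortedPair-unique {s = s} {t} _ _ _ _ with toℕ s <? toℕ t
sortedPair-unique s≢t (inj₁ refl) (inj₁ refl) _ | _ = ⊥-elim (s≢t refl)
sortedPair-unique _ (inj₁ refl) (inj₂ refl) _ | yes _ = refl
sortedPair-unique _ (inj₁ refl) (inj₂ refl) u<w | no s≮t = ⊥-elim (s≮t u<w)
sortedPair-unique _ (inj₂ refl) (inj₁ refl) u<w | yes t<s = ⊥-elim (<-asym u<w t<s)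
sortedPair-unique _ (inj₂ refl) (inj₁ refl) _ | no _ = refl
sortedPair-unique s≢t (inj₂ refl) (inj₂ refl) _ | _ = ⊥-elim (s≢t refl)

∨-true⁻ : ∀ {x y} → x ∨ y ≡ true → x ≡ true ⊎ y ≡ true
∨-true⁻ {true} _ = inj₁ refl
∨-true⁻ {false} y≡true = inj₂ y≡true

∧-true⁻ : ∀ {x y} → x ∧ y ≡ true → x ≡ true × y ≡ true
∧-true⁻ {true} {true} _ = refl , refl

does-true⁻ : ∀ {P : Set} (P? : Dec P) → does P? ≡ true → P
does-true⁻ (yes p) _ = p

-- Walks and paths

-- All vertices of a walk satisfy P; thus Walk R (t ≢_) is a walk in R − t.
data Walk {A : Set} (R : A → A → Set) (P : A → Set) : A → A → Set where
  [_]    : ∀ {x} → P x → Walk R P x x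
  _∷⟨_⟩_ : ∀ {x y z} → P x → R x y → Walk R P y z → Walk R P x z

module _ {A : Set} {R : A → A → Set} {P : A → Set} where

  _++ʷ_ : ∀ {x y z} → Walk R P x y → Walk R P y z → Walk R P x z
  [ _ ] ++ʷ w′ = w′
  (p ∷⟨ r ⟩ w) ++ʷ w′ = p ∷⟨ r ⟩ (w ++ʷ w′)

  headʷ : ∀ {x y} → Walk R P x y → P x
  headʷ [ p ] = p
  headʷ (p ∷⟨ _ ⟩ _) = p

  lastʷ : ∀ {x y} → Walk R P x y → P y
  lastʷ [ p ] = p
  lastʷ (_ ∷⟨ _ ⟩ w) = lastʷ w

  reverseʷ : (∀ {x y} → R x y → R y x) → ∀ {x y} → Walk R P x y → Walk R P y x
  reverseʷ R-sym [ p ] = [ p ]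
  reverseʷ R-sym (p ∷⟨ r ⟩ w) = reverseʷ R-sym w ++ʷ (headʷ w ∷⟨ R-sym r ⟩ [ p ])

  path⇒walk : ∀ {x z vs} → PathFrom R x z vs → All P vs → Walk R P x z
  path⇒walk here (p ∷ []) = [ p ]
  path⇒walk (step r path) (p ∷ ps) = p ∷⟨ r ⟩ path⇒walk path ps

  private
    suffix : ∀ {x y z vs} → PathFrom R y z vs → Unique vs → All P vs → x ∈ vs →
             Σ (List A) λ ws → PathFrom R x z ws × Unique ws × All P ws
    suffix here uniq ps (here refl) = _ , here , uniq , ps
    suffix path@(step _ _) uniq ps (here refl) = _ , path , uniq , ps
    suffix (step _ path) (_ ∷ uniq) (_ ∷ ps) (there x∈vs) = suffix path uniq ps x∈vs

  walk⇒path : DecidableEquality A → ∀ {x z} → Walk R P x z →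
              Σ (List A) λ vs → Path R x z vs × All P vs
  walk⇒path _≟_ [ p ] = _ , (here , [] ∷ []) , p ∷ []
  walk⇒path _≟_ (_∷⟨_⟩_ {x} p r w) with walk⇒path _≟_ w
  ... | vs , (path , uniq) , ps with any? (x ≟_) vs
  ...   | yes x∈vs = let ws , path′ , uniq′ , ps′ = suffix path uniq ps x∈vs in ws , (path′ , uniq′) , ps′
  ...   | no x∉vs = x ∷ vs , (step r path , ¬Any⇒All¬ vs x∉vs ∷ uniq) , p ∷ ps

Reaches : ∀ {A : Set} → (A → A → Set) → A → A → Set
Reaches R = Walk R (λ _ → ⊤)

path⇒reaches : ∀ {A : Set} {R : A → A → Set} {x y vs} → PathFrom R x y vs → Reaches R x y
path⇒reaches path = path⇒walk path (All.universal (λ _ → tt) _)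

path-avoids? : ∀ {A : Set} {R : A → A → Set} → DecidableEquality A → ∀ s {x y vs} → PathFrom R x y vs →
  s ∈ vs ⊎ Walk R (s ≢_) x y
path-avoids? _≟_ s {vs = vs} path with any? (s ≟_) vs
... | yes s∈vs = inj₁ s∈vs
... | no s∉vs = inj₂ (path⇒walk path (¬Any⇒All¬ vs s∉vs))

mapʷ : ∀ {A : Set} {R R′ : A → A → Set} {P P′ : A → Set} →
       (∀ {x y} → R x y → R′ x y) → (∀ {x} → P x → P′ x) → ∀ {x y} → Walk R P x y → Walk R′ P′ x y
mapʷ f g [ p ] = [ g p ]
mapʷ f g (p ∷⟨ r ⟩ w) = g p ∷⟨ f r ⟩ mapʷ f g w

module _ {A : Set} {R : A → A → Set} where

  head∈ : ∀ {x y vs} → PathFrom R x y vs → x ∈ vs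
  head∈ here = here refl
  head∈ (step _ _) = here refl

  last∈ : ∀ {x y vs} → PathFrom R x y vs → y ∈ vs
  last∈ here = here refl
  last∈ (step _ path) = there (last∈ path)

  2≤length : ∀ {x y vs} → PathFrom R x y vs → x ≢ y → 2 ≤ length vs
  2≤length here x≢y = ⊥-elim (x≢y refl)
  2≤length (step _ here) _ = s≤s (s≤s z≤n)
  2≤length (step _ (step _ _)) _ = s≤s (s≤s z≤n)

loop-trivial : ∀ {A : Set} {R : A → A → Set} {x vs} → PathFrom R x x vs → Unique vs → vs ≡ x ∷ []
loop-trivial here _ = refl
loop-trivial (step _ path) (x∉ ∷ _) = ⊥-elim (All.lookup x∉ (last∈ path) refl)

module DecidableConnectivity {A : Set} (_≟_ : DecidableEquality A) {R : A → A → Set}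
  (R? : ∀ x y → Dec (R x y)) (elems : List A) (∈-elems : ∀ x → x ∈ elems) where

  open Data.List.Relation.Unary.Unique.DecPropositional _≟_ using (unique?)

  pathFrom? : ∀ x z vs → Dec (PathFrom R x z vs)
  pathFrom? x z [] = no λ ()
  pathFrom? x z (v ∷ []) with v ≟ x | x ≟ z
  ... | yes refl | yes refl = yes here
  ... | no v≢x | _ = no λ { here → v≢x refl }
  ... | yes refl | no x≢z = no λ { here → x≢z refl }
  pathFrom? x z (v ∷ w ∷ vs) with v ≟ x | R? x w | pathFrom? w z (w ∷ vs)
  ... | no v≢x | _ | _ = no λ { (step _ _) → v≢x refl }
  ... | yes refl | yes r | yes path = yes (step r path)
  ... | yes refl | no ¬r | _ = no λ { (step r here) → ¬r r ; (step r (step _ _)) → ¬r r }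
  ... | yes refl | yes _ | no ¬path = no λ { (step _ path@here) → ¬path path ; (step _ path@(step _ _)) → ¬path path }

  lists : ℕ → List (List A)
  lists zero = [] ∷ []
  lists (suc k) = [] ∷ concatMap (λ x → map (x ∷_) (lists k)) elems

  ∈-lists : ∀ k vs → length vs ≤ k → vs ∈ lists k
  ∈-lists zero [] _ = here refl
  ∈-lists (suc k) [] _ = here refl
  ∈-lists (suc k) (v ∷ vs) (s≤s len≤k) =
    there (∈-concatMap⁺ (λ x → map (x ∷_) (lists k)) (lose (∈-elems v) (∈-map⁺ (v ∷_) (∈-lists k vs len≤k))))

  -- A path repeats no vertex, so it is among the lists of length at most length elems.
  path? : ∀ x z → Dec (Σ (List A) (Path R x z))
  path? x z with any? (λ vs → pathFrom? x z vs ×-dec unique? vs) (lists (length elems))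
  ... | yes found = yes (satisfied found)
  ... | no none = no λ (vs , path) →
    none (lose (∈-lists _ vs (length-≤-⊆ (proj₂ path) (λ {x} _ → ∈-elems x))) path)

  reaches? : ∀ x z → Dec (Reaches R x z)
  reaches? x z = map′ (λ (_ , path) → path⇒reaches (proj₁ path))
                        (λ w → let vs , path , _ = walk⇒path _≟_ w in vs , path) (path? x z)

-- Acyclic relations

acyclic-⊆ : ∀ {A : Set} {R R′ : A → A → Set} → (∀ {x y} → R′ x y → R x y) → Acyclic R → Acyclic R′
acyclic-⊆ {R = R} {R′} R′⊆R acyclic x y vs (path , uniq) 3≤ r = acyclic x y vs (narrow path , uniq) 3≤ (R′⊆R r)
  where
  narrow : ∀ {x y vs} → PathFrom R′ x y vs → PathFrom R x y vs
  narrow here = here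
  narrow (step r path) = step (R′⊆R r) (narrow path)

module AcyclicSymmetric {A : Set} (_≟_ : DecidableEquality A) {R : A → A → Set}
  (R-sym : ∀ {x y} → R x y → R y x) (acyclic : Acyclic R) where

  no-cycle : ∀ {s a t} → R s a → a ≢ t → Walk R (s ≢_) a t → ¬ R t s
  no-cycle {s} rsa a≢t w with walk⇒path _≟_ w
  ... | vs , (path , uniq) , s∉vs =
    acyclic s _ (s ∷ vs) (step rsa path , s∉vs ∷ uniq) (s≤s (2≤length path a≢t))

  unique-neighbour : ∀ {t s s′ r} → R t s → R t s′ →
    Walk R (t ≢_) s r → Walk R (t ≢_) s′ r → s ≡ s′
  unique-neighbour {s = s} {s′} rts rts′ w w′ with s ≟ s′
  ... | yes s≡s′ = s≡s′
  ... | no s≢s′ = ⊥-elim (no-cycle rts s≢s′ (w ++ʷ reverseʷ R-sym w′) (R-sym rts′))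

  edge-separates : ∀ {s t u w} → R t s → Walk R (t ≢_) s u → Walk R (s ≢_) t w →
    ¬ Walk R (s ≢_) u w
  edge-separates rts ws wt wu with walk⇒path _≟_ ws
  ... | _ , (here , _) , _ = headʷ wu refl
  ... | _ , (step rsa path , s∉vs ∷ _) , _ ∷ t∉vs =
    no-cycle rsa (λ a≡t → All.lookup t∉vs (head∈ path) (sym a≡t))
      (path⇒walk path s∉vs ++ʷ (wu ++ʷ reverseʷ R-sym wt)) rts

  crossing-edge-incident : ∀ {s t a b} → R t s → Walk R (t ≢_) s a → Walk R (s ≢_) t b →
    R a b → s ≡ a ⊎ s ≡ b
  crossing-edge-incident {s} {a = a} {b} rts wa wb rab with s ≟ a | s ≟ b
  ... | yes s≡a | _ = inj₁ s≡a
  ... | no _ | yes s≡b = inj₂ s≡b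
  ... | no s≢a | no s≢b = ⊥-elim (edge-separates rts wa wb (s≢a ∷⟨ rab ⟩ [ s≢b ]))

Link : ∀ {A : Set} → A → A → A → A → Set
Link a b x y = (x ≡ a × y ≡ b) ⊎ (x ≡ b × y ≡ a)

module AddEdge {A : Set} (_≟_ : DecidableEquality A) {R : A → A → Set}
  (R-sym : ∀ {x y} → R x y → R y x) (acyclic : Acyclic R)
  {a b : A} (a≁b : ¬ Reaches R a b) where

  R⁺ : A → A → Set
  R⁺ x y = R x y ⊎ Link a b x y

  private
    End : A → Set
    End x = x ≡ a ⊎ x ≡ b

    link-ends : ∀ {x y} → Link a b x y → End x × End y
    link-ends (inj₁ (x≡a , y≡b)) = inj₁ x≡a , inj₂ y≡b
    link-ends (inj₂ (x≡b , y≡a)) = inj₂ x≡b , inj₁ y≡a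

    ends-unconnected : ∀ {x y} → End x → End y → x ≢ y → ¬ Reaches R x y
    ends-unconnected (inj₁ refl) (inj₁ refl) x≢y _ = x≢y refl
    ends-unconnected (inj₁ refl) (inj₂ refl) _ w = a≁b w
    ends-unconnected (inj₂ refl) (inj₁ refl) _ w = a≁b (reverseʷ R-sym w)
    ends-unconnected (inj₂ refl) (inj₂ refl) x≢y _ = x≢y refl

    link-unconnected : ∀ {x y} → Link a b x y → ¬ Reaches R x y
    link-unconnected (inj₁ (refl , refl)) w = a≁b w
    link-unconnected (inj₂ (refl , refl)) w = a≁b (reverseʷ R-sym w)

    link-meets : ∀ {p q c d} → Link a b p q → Link a b c d → p ≡ c ⊎ p ≡ d
    link-meets (inj₁ (refl , _)) (inj₁ (c≡a , _)) = inj₁ (sym c≡a)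
    link-meets (inj₁ (refl , _)) (inj₂ (_ , d≡a)) = inj₂ (sym d≡a)
    link-meets (inj₂ (refl , _)) (inj₁ (_ , d≡b)) = inj₂ (sym d≡b)
    link-meets (inj₂ (refl , _)) (inj₂ (c≡b , _)) = inj₁ (sym c≡b)

    avoid-link : ∀ {p q s y vs} → Link a b p q → p ∉ vs → PathFrom R⁺ s y vs → PathFrom R s y vs
    avoid-link _ _ here = here
    avoid-link l p∉ (step (inj₁ r) path) = step r (avoid-link l (λ p∈ → p∉ (there p∈)) path)
    avoid-link l p∉ (step (inj₂ l′) path) with link-meets l l′
    ... | inj₁ refl = ⊥-elim (p∉ (here refl))
    ... | inj₂ refl = ⊥-elim (p∉ (there (head∈ path)))

    data LinkSplit (x y : A) : List A → Set where
      no-link  : ∀ {vs} → PathFrom R x y vs → LinkSplit x y vs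
      via-link : ∀ {p q pre post} → PathFrom R x p pre → Link a b p q → PathFrom R⁺ q y post →
                 LinkSplit x y (pre ++ post)

    first-link : ∀ {x y vs} → PathFrom R⁺ x y vs → LinkSplit x y vs
    first-link here = no-link here
    first-link (step (inj₂ l) path) = via-link here l path
    first-link (step (inj₁ r) path) with first-link path
    ... | no-link path′ = no-link (step r path′)
    ... | via-link pre l post = via-link (step r pre) l post

  acyclic⁺ : Acyclic R⁺
  acyclic⁺ x y vs (path , uniq) 3≤ closing with first-link path
  acyclic⁺ x y vs (path , uniq) 3≤ (inj₁ r) | no-link path′ = acyclic x y vs (path′ , uniq) 3≤ r
  acyclic⁺ x y vs (path , uniq) 3≤ (inj₂ l) | no-link path′ =
    link-unconnected l (reverseʷ R-sym (path⇒reaches path′))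
  acyclic⁺ x y vs (path , uniq) 3≤ closing | via-link {p} {q} {pre} {post} path₁ l path₂ =
    closes closing
    where
    path₂′ : PathFrom R q y post
    path₂′ = avoid-link l (Unique-++-disjoint pre uniq (last∈ path₁)) path₂
    closes : ¬ R⁺ y x
    closes (inj₁ r) = link-unconnected l
      (reverseʷ R-sym (path⇒reaches path₂′ ++ʷ (tt ∷⟨ r ⟩ path⇒reaches path₁)))
    closes (inj₂ l′) with x ≟ p | q ≟ y
    ... | no x≢p | _ = ends-unconnected (proj₂ (link-ends l′)) (proj₁ (link-ends l)) x≢p (path⇒reaches path₁)
    ... | yes _ | no q≢y = ends-unconnected (proj₂ (link-ends l)) (proj₁ (link-ends l′)) q≢y (path⇒reaches path₂′)
    ... | yes refl | yes refl = 3≰2 (subst (λ zs → 3 ≤ length zs) pre++post≡[x,y] 3≤)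
      where
      pre++post≡[x,y] : pre ++ post ≡ x ∷ y ∷ []
      pre++post≡[x,y] = cong₂ _++_ (loop-trivial path₁ (proj₁ (Unique-++⁻ pre uniq)))
                                   (loop-trivial path₂′ (proj₂ (Unique-++⁻ pre uniq)))
      3≰2 : ¬ 3 ≤ 2
      3≰2 (s≤s (s≤s ()))

-- Spanning trees

module _ {n : ℕ} (G : Graph n) where

  _⊆ᴱ_ : EdgeSubset G → EdgeSubset G → Set
  H ⊆ᴱ H′ = ∀ {u w} → InF H u w → InF H′ u w

  InF-sym : (H : EdgeSubset G) → ∀ {x y} → InF H x y → InF H y x
  InF-sym H {x} {y} r = trans (sym (ssym H x y)) r

  InF-irrefl : (H : EdgeSubset G) → ∀ v → sel H v v ≡ false
  InF-irrefl H v with sel H v v in e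
  ... | false = refl
  ... | true with trans (sym (sub H v v e)) (irrefl G v)
  ...   | ()

  InF-≢ : (H : EdgeSubset G) → ∀ {u w} → InF H u w → u ≢ w
  InF-≢ H {u} e refl with trans (sym e) (InF-irrefl H u)
  ... | ()

  private
    Link? : (a b x y : Fin n) → Dec (Link a b x y)
    Link? a b x y = (x ≟F a ×-dec y ≟F b) ⊎-dec (x ≟F b ×-dec y ≟F a)

    Link-sym : ∀ {a b x y : Fin n} → Link a b x y → Link a b y x
    Link-sym (inj₁ (x≡a , y≡b)) = inj₂ (y≡b , x≡a)
    Link-sym (inj₂ (x≡b , y≡a)) = inj₁ (y≡a , x≡b)

    Link⇒E : ∀ {a b x y} → E G a b → Link a b x y → E G x y
    Link⇒E eab (inj₁ (refl , refl)) = eab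
    Link⇒E {a} {b} eab (inj₂ (refl , refl)) = trans (Graph.sym G b a) eab

  addEdge : EdgeSubset G → (a b : Fin n) → E G a b → EdgeSubset G
  addEdge H a b eab = record
    { sel  = λ x y → sel H x y ∨ does (Link? a b x y)
    ; ssym = λ x y → cong₂ _∨_ (ssym H x y) (does-⇔ (mk⇔ Link-sym Link-sym) (Link? a b x y) (Link? a b y x))
    ; sub  = λ x y e → [ sub H x y , (λ l → Link⇒E eab (does-true⁻ (Link? a b x y) l)) ]′ (∨-true⁻ e)
    }

  module _ {H : EdgeSubset G} {a b : Fin n} {eab : E G a b} where

    addEdge⁻ : ∀ {x y} → InF (addEdge H a b eab) x y → InF H x y ⊎ Link a b x y
    addEdge⁻ {x} {y} e = map₂ (does-true⁻ (Link? a b x y)) (∨-true⁻ e)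

    ⊆-addEdge : H ⊆ᴱ addEdge H a b eab
    ⊆-addEdge {x} {y} e = cong (_∨ does (Link? a b x y)) e

    addEdge-new : InF (addEdge H a b eab) a b
    addEdge-new = trans (cong (sel H a b ∨_) (dec-true (Link? a b a b) (inj₁ (refl , refl)))) (∨-zeroʳ _)

  record Extension (H : EdgeSubset G) (ps : List (Fin n × Fin n)) : Set where
    field
      edgeSet  : EdgeSubset G
      acyclic  : Acyclic (InF edgeSet)
      ⊇-base   : H ⊆ᴱ edgeSet
      reaches  : ∀ {a b} → (a , b) ∈ ps → E G a b → Reaches (InF edgeSet) a b

  open Extension

  _⨾_ : ∀ {H qs ps} (X : Extension H qs) → Extension (edgeSet X) ps → Extension H (qs ++ ps)
  _⨾_ {qs = qs} X Y = record
    { edgeSet = edgeSet Y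
    ; acyclic = acyclic Y
    ; ⊇-base  = ⊇-base Y ∘ ⊇-base X
    ; reaches = λ p∈ e → [ (λ p∈qs → mapʷ (⊇-base Y) id (reaches X p∈qs e)) , (λ p∈ps → reaches Y p∈ps e) ]′ (∈-++⁻ qs p∈)
    }

  extend-by : ∀ (a b : Fin n) (H : EdgeSubset G) → Acyclic (InF H) → Extension H ((a , b) ∷ [])
  extend-by a b H acyc with adj G a b ≟B true
  ... | no ¬eab = record { edgeSet = H ; acyclic = acyc ; ⊇-base = id
                         ; reaches = λ { (here refl) eab → ⊥-elim (¬eab eab) } }
  ... | yes eab with DecidableConnectivity.reaches? _≟F_ (λ x y → sel H x y ≟B true) (allFin n) ∈-allFin a b
  ...   | yes a⇝b = record { edgeSet = H ; acyclic = acyc ; ⊇-base = id ; reaches = λ { (here refl) _ → a⇝b } }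
  ...   | no a≁b = record
    { edgeSet = addEdge H a b eab
    ; acyclic = acyclic-⊆ (addEdge⁻ {H} {eab = eab}) (AddEdge.acyclic⁺ _≟F_ (InF-sym H) acyc a≁b)
    ; ⊇-base  = ⊆-addEdge {H} {eab = eab}
    ; reaches = λ { (here refl) _ → tt ∷⟨ addEdge-new {H} {eab = eab} ⟩ [ tt ] }
    }

  extend : ∀ ps (H : EdgeSubset G) → Acyclic (InF H) → Extension H ps
  extend [] H acyc = record { edgeSet = H ; acyclic = acyc ; ⊇-base = id ; reaches = λ () }
  extend ((a , b) ∷ ps) H acyc = X ⨾ extend ps (edgeSet X) (acyclic X)
    where
    X : Extension H ((a , b) ∷ [])
    X = extend-by a b H acyc

  spanning-tree-⊇ : Connected (E G) → (H : EdgeSubset G) → Acyclic (InF H) →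
    Σ (EdgeSubset G) λ T → IsSpanningTree G T × H ⊆ᴱ T
  spanning-tree-⊇ conn H acyc = edgeSet X , (connected′ , acyclic X) , ⊇-base X
    where
    X : Extension H (cartesianProduct (allFin n) (allFin n))
    X = extend (cartesianProduct (allFin n) (allFin n)) H acyc
    edge-reaches : ∀ {x y vs} → PathFrom (E G) x y vs → Reaches (InF (edgeSet X)) x y
    edge-reaches here = [ tt ]
    edge-reaches {x} (step {y = y} e path) =
      reaches X (∈-cartesianProduct⁺ (∈-allFin x) (∈-allFin y)) e ++ʷ edge-reaches path
    connected′ : Connected (InF (edgeSet X))
    connected′ u w = let vs , path , _ = walk⇒path _≟F_ (edge-reaches (proj₁ (proj₂ (conn u w)))) in vs , path

module _ {n : ℕ} {G : Graph n} where

  complementᴱ : EdgeSubset G → EdgeSubset G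
  complementᴱ F = record
    { sel  = λ u w → adj G u w ∧ not (sel F u w)
    ; ssym = λ u w → cong₂ _∧_ (Graph.sym G u w) (cong not (ssym F u w))
    ; sub  = λ u w e → proj₁ (∧-true⁻ e)
    }

  complementᴱ⇒Minus : ∀ {F u w} → InF (complementᴱ F) u w → Minus G F u w
  complementᴱ⇒Minus {F} {u} {w} e with ∧-true⁻ {adj G u w} e
  ... | euw , ¬f = euw , trans (sym (not-involutive (sel F u w))) (cong not ¬f)

  spanning-tree-with-Eloc-⊆ : Connected (E G) → (F : EdgeSubset G) → IsFeedbackEdgeSet G F →
    Σ (EdgeSubset G) λ T → IsSpanningTree G T × (∀ v {p} → Eloc G T v p → EdgesOf F p)
  spanning-tree-with-Eloc-⊆ conn F fes
    with spanning-tree-⊇ G conn (complementᴱ F) (acyclic-⊆ (complementᴱ⇒Minus {F}) fes)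
  ... | T , spanning , ⊇complement = T , spanning , λ v (u<w , euw , ∉T , _) → u<w , outside-T⇒∈F euw ∉T
    where
    outside-T⇒∈F : ∀ {u w} → E G u w → sel T u w ≡ false → InF F u w
    outside-T⇒∈F {u} {w} euw ∉T with sel F u w in f
    ... | true = refl
    ... | false with trans (sym ∉T) (⊇complement (cong₂ (λ x y → x ∧ not y) euw f))
    ...   | ()

  lfen-bounded-by-feedback : Connected (E G) → ∀ {k} (F : EdgeSubset G) → IsFeedbackEdgeSet G F →
    CardAtMost (EdgesOf F) k → Σ (EdgeSubset G) λ T → IsSpanningTree G T × LfenTAtMost G T k
  lfen-bounded-by-feedback conn F fes (xs , len , cover) =
    let T , spanning , Eloc⊆F = spanning-tree-with-Eloc-⊆ conn F fes
    in T , spanning , λ v → xs , len , λ p loc → cover p (Eloc⊆F v loc)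

-- Three-centers

module Spokes {V : Set} (_≟_ : DecidableEquality V) {X : V → Set} (X? : Decidable X)
  {hub : V} (hub∈X : X hub) (spoke : V → V × V)
  (spoke-joins : ∀ {x} → ¬ X x → ThreeCenter.Joins _≟_ (spoke x) x hub) where

  open ThreeCenter _≟_

  inner : List V → List V
  inner = filter (∁? X?)

  record Invariant (l : ℕ) (g : MG V) : Set where
    field
      unique    : Unique (verts g)
      terminals : ∀ {x} → x ∈ verts g → X x → x ≡ hub
      spokes    : ∀ {x} → x ∈ verts g → ¬ X x → spoke x ∈ edges g
      few-edges : length (edges g) ≤ length (inner (verts g)) + l

  open Invariant

  private
    joins-incident : ∀ {e x a} → Joins e x a → Incident e x
    joins-incident (inj₁ refl) = inj₁ refl
    joins-incident (inj₂ refl) = inj₂ refl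

    incident-joins : ∀ {e x a y} → Joins e x a → Incident e y → y ≡ x ⊎ y ≡ a
    incident-joins (inj₁ refl) (inj₁ refl) = inj₁ refl
    incident-joins (inj₁ refl) (inj₂ refl) = inj₂ refl
    incident-joins (inj₂ refl) (inj₁ refl) = inj₂ refl
    incident-joins (inj₂ refl) (inj₂ refl) = inj₁ refl

    inner≢hub : ∀ {x} → ¬ X x → x ≢ hub
    inner≢hub ¬Xx refl = ¬Xx hub∈X

  spoke-incident : ∀ {x} → ¬ X x → Incident (spoke x) x
  spoke-incident ¬Xx = joins-incident (spoke-joins ¬Xx)

  spoke-hub : ∀ {x} → ¬ X x → Incident (spoke x) hub
  spoke-hub ¬Xx with spoke-joins ¬Xx
  ... | inj₁ eq = inj₂ (cong proj₂ eq)
  ... | inj₂ eq = inj₁ (cong proj₁ eq)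

  spoke-avoids : ∀ {x y} → ¬ X x → ¬ X y → y ≢ x → ¬ Incident (spoke y) x
  spoke-avoids ¬Xx ¬Xy y≢x inc with incident-joins (spoke-joins ¬Xy) inc
  ... | inj₁ x≡y = y≢x (sym x≡y)
  ... | inj₂ x≡hub = inner≢hub ¬Xx x≡hub

  spoke-injective : ∀ {x y} → ¬ X x → ¬ X y → spoke x ≡ spoke y → x ≡ y
  spoke-injective ¬Xx ¬Xy eq with incident-joins (spoke-joins ¬Xy) (subst (λ e → Incident e _) eq (spoke-incident ¬Xx))
  ... | inj₁ x≡y = x≡y
  ... | inj₂ x≡hub = ⊥-elim (inner≢hub ¬Xx x≡hub)

  spoke-not-loop : ∀ {x} → ¬ X x → spoke x ≢ (x , x)
  spoke-not-loop ¬Xx eq with subst (λ e → Incident e _) eq (spoke-hub ¬Xx)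
  ... | inj₁ x≡hub = inner≢hub ¬Xx x≡hub
  ... | inj₂ x≡hub = inner≢hub ¬Xx x≡hub

  module _ {l : ℕ} where

    private
      spoke-∈-rest : ∀ {x y e es rest} → ¬ X x → ¬ X y → y ≢ x → Incident e x →
        es ↭ e ∷ rest → spoke y ∈ es → spoke y ∈ rest
      spoke-∈-rest ¬Xx ¬Xy y≢x inc perm spoke∈ with ∈-resp-↭ perm spoke∈
      ... | here refl = ⊥-elim (spoke-avoids ¬Xx ¬Xy y≢x inc)
      ... | there spoke∈rest = spoke∈rest

      remove-vertex : ∀ {vs es es′ x} → Invariant l (mg vs es) → x ∈ vs → ¬ X x →
        (∀ {y} → ¬ X y → y ≢ x → spoke y ∈ es → spoke y ∈ es′) → suc (length es′) ≤ length es →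
        Invariant l (mg (removeV x vs) es′)
      remove-vertex {vs} {x = x} inv x∈vs ¬Xx keep shorter = record
        { unique    = UniqueP.filter⁺ _ (unique inv)
        ; terminals = λ y∈ → terminals inv (proj₁ (∈-filter⁻ _ {xs = vs} y∈))
        ; spokes    = λ y∈ ¬Xy → let y∈vs , y≢x = ∈-filter⁻ _ {xs = vs} y∈
                                 in keep ¬Xy y≢x (spokes inv y∈vs ¬Xy)
        ; few-edges = +-cancelˡ-≤ 1 _ _ (≤-trans shorter (≤-trans (few-edges inv)
            (≤-reflexive (cong (_+ l) (length-filter-removeV _≟_ (∁? X?) (unique inv) x∈vs ¬Xx)))))
        }

    step-preserves : ∀ {g g′} → Step X g g′ → Invariant l g → Invariant l g′
    step-preserves (del0 x∈ ¬Xx ni) inv =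
      ⊥-elim (All.lookup ni (spokes inv x∈ ¬Xx) (spoke-incident ¬Xx))
    step-preserves (del1 x∈ ¬Xx perm j _ _) inv =
      remove-vertex inv x∈ ¬Xx (λ ¬Xy y≢x → spoke-∈-rest ¬Xx ¬Xy y≢x (joins-incident j) perm)
        (≤-reflexive (sym (↭-length perm)))
    step-preserves (delLoop x∈ ¬Xx perm ni) inv with ∈-resp-↭ perm (spokes inv x∈ ¬Xx)
    ... | here eq = ⊥-elim (spoke-not-loop ¬Xx eq)
    ... | there spoke∈rest = ⊥-elim (All.lookup ni spoke∈rest (spoke-incident ¬Xx))
    step-preserves (suppress x∈ ¬Xx perm j₁ j₂ _ _ _) inv =
      remove-vertex inv x∈ ¬Xx
        (λ ¬Xy y≢x spoke∈ → there (spoke-∈-rest ¬Xx ¬Xy y≢x (joins-incident j₂) ↭-refl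
                                    (spoke-∈-rest ¬Xx ¬Xy y≢x (joins-incident j₁) perm spoke∈)))
        (≤-reflexive (sym (↭-length perm)))

    steps-preserve : ∀ {g g′} → Star (Step X) g g′ → Invariant l g → Invariant l g′
    steps-preserve ε inv = inv
    steps-preserve (s ◅ ss) inv = steps-preserve ss (step-preserves s inv)

    private module Count {g : MG V} (inv : Invariant l g) where

      N : List V
      N = inner (verts g)

      k : ℕ
      k = length N

      ∈N⁻ : ∀ {x} → x ∈ N → x ∈ verts g × ¬ X x
      ∈N⁻ = ∈-filter⁻ (∁? X?) {xs = verts g}

      unique-N : Unique N
      unique-N = UniqueP.filter⁺ (∁? X?) (unique inv)

      hits : V → ℕ
      hits y = length (filter (y ≟_) N)

      hits-hub : hits hub ≡ 0
      hits-hub = length-filter-≡-∉ _≟_ (λ hub∈N → proj₂ (∈N⁻ hub∈N) hub∈X)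

      at-hub? : Decidable (λ e → Incident e hub)
      at-hub? e = (proj₁ e ≟ hub) ⊎-dec (proj₂ e ≟ hub)

      load : V × V → ℕ
      load e = sum (map (λ x → ind (proj₁ e ≟ x) + ind (proj₂ e ≟ x)) N)

      load+hub≤2 : ∀ e → load e + ind (at-hub? e) ≤ 2
      load+hub≤2 e@(a , b) = ≤-trans (≤-reflexive (cong (_+ ind (at-hub? e)) load≡hits)) hits-bound
        where
        load≡hits : load e ≡ hits a + hits b
        load≡hits = trans (sum-map-+ (λ x → ind (a ≟ x)) (λ x → ind (b ≟ x)) N)
                          (cong₂ _+_ (sum-map-ind _≟_ (a ≟_) N) (sum-map-ind _≟_ (b ≟_) N))
        hits-≤1 : ∀ y → hits y ≤ 1
        hits-≤1 y = length-filter-≡-≤1 _≟_ y unique-N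
        hits-bound : hits a + hits b + ind (at-hub? e) ≤ 2
        hits-bound with at-hub? e
        ... | yes (inj₁ refl) rewrite hits-hub = +-monoˡ-≤ 1 (hits-≤1 b)
        ... | yes (inj₂ refl) rewrite hits-hub | +-identityʳ (hits a) = +-monoˡ-≤ 1 (hits-≤1 a)
        ... | no _ rewrite +-identityʳ (hits a + hits b) = +-mono-≤ (hits-≤1 a) (hits-≤1 b)

      spokes-at-hub : k ≤ sum (map (λ e → ind (at-hub? e)) (edges g))
      spokes-at-hub = ≤-trans
        (length-≤-injection spoke unique-N
          (λ x∈ y∈ → spoke-injective (proj₂ (∈N⁻ x∈)) (proj₂ (∈N⁻ y∈)))
          (λ x∈ → let x∈vs , ¬Xx = ∈N⁻ x∈ in ∈-filter⁺ at-hub? (spokes inv x∈vs ¬Xx) (spoke-hub ¬Xx)))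
        (≤-reflexive (sym (sum-map-ind _≟_ at-hub? (edges g))))

      inner-bound : Irreducible X g → k ≤ l
      inner-bound irr = m*3+m≤[m+n]*2⇒m≤n k l (begin
        k * 3 + k
          ≤⟨ +-mono-≤ degrees-≥ spokes-at-hub ⟩
        sum (map load es) + sum (map (λ e → ind (at-hub? e)) es)
          ≡⟨ sum-map-+ load (λ e → ind (at-hub? e)) es ⟨
        sum (map (λ e → load e + ind (at-hub? e)) es)
          ≤⟨ sum-map-≤ _ (λ _ → 2) es (All.universal load+hub≤2 es) ⟩
        sum (map (λ _ → 2) es)
          ≡⟨ sum-map-const 2 es ⟩
        length es * 2
          ≤⟨ *-monoˡ-≤ 2 (few-edges inv) ⟩
        (k + l) * 2 ∎)
        where
        open ≤-Reasoning
        es : List (V × V)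
        es = edges g
        degrees-≥ : k * 3 ≤ sum (map load es)
        degrees-≥ = begin
          k * 3                                     ≡⟨ sum-map-const 3 N ⟨
          sum (map (λ _ → 3) N)                     ≤⟨ sum-map-≤ (λ _ → 3) (λ x → deg x es) N
                                                         (All.tabulate λ x∈ → irr _ (proj₁ (∈N⁻ x∈)) (proj₂ (∈N⁻ x∈))) ⟩
          sum (map (λ x → deg x es) N)              ≡⟨ sum-map-swap (λ x e → ind (proj₁ e ≟ x) + ind (proj₂ e ≟ x)) N es ⟩
          sum (map load es)                         ∎

      size-bound : length (verts g) ≤ suc k
      size-bound = begin
        length (verts g)                                   ≡⟨ length-filter-∁ X? (verts g) ⟨
        length (filter X? (verts g)) + k                   ≤⟨ +-monoˡ-≤ k terminals-≤1 ⟩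
        suc k                                              ∎
        where
        open ≤-Reasoning
        terminals-≤1 : length (filter X? (verts g)) ≤ 1
        terminals-≤1 = length-≤-⊆ {ys = hub ∷ []} (UniqueP.filter⁺ X? (unique inv))
          (λ x∈ → let x∈vs , Xx = ∈-filter⁻ X? {xs = verts g} x∈ in here (terminals inv x∈vs Xx))

    irreducible-size : ∀ {g} → Invariant l g → Irreducible X g → length (verts g) ≤ l + 1
    irreducible-size inv irr = ≤-trans size-bound (≤-trans (s≤s (inner-bound irr)) (≤-reflexive (+-comm 1 l)))
      where open Count inv

-- The decomposition along a spanning tree

module SpanningTreeDecomposition {n : ℕ} (G : Graph (suc n)) (T : EdgeSubset G)
  (spanning : IsSpanningTree G T) where

  decomposition : TCD G
  decomposition = record
    { m         = n
    ; tree      = record { adj = sel T ; sym = ssym T ; irrefl = InF-irrefl G T }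
    ; connected = proj₁ spanning
    ; acyclic   = proj₂ spanning
    ; bag       = id
    }

  open AcyclicSymmetric _≟F_ (InF-sym G T) (proj₂ spanning) public

  branch⇒walk : ∀ {t s r} → Branch decomposition t s r → Walk (InF T) (t ≢_) s r
  branch⇒walk (_ , ps , (path , _) , t∉ps) = path⇒walk path (¬Any⇒All¬ ps t∉ps)

  module _ {s t a b : Fin (suc n)} (b-t : Branch decomposition t s a) (b-s : Branch decomposition s t b) where

    crossing-tree-edge : InF T a b → (s ≡ a ⊎ s ≡ b) × (t ≡ a ⊎ t ≡ b)
    crossing-tree-edge e =
      crossing-edge-incident (proj₁ b-t) (branch⇒walk b-t) (branch⇒walk b-s) e ,
      swap (crossing-edge-incident (proj₁ b-s) (branch⇒walk b-s) (branch⇒walk b-t) (InF-sym G T e))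

    crossing-separated : ¬ Walk (InF T) (s ≢_) a b
    crossing-separated = edge-separates (proj₁ b-t) (branch⇒walk b-t) (branch⇒walk b-s)

  Crossing : (s t u w : Fin (suc n)) → Set
  Crossing s t u w = (Branch decomposition t s u × Branch decomposition s t w)
                   ⊎ (Branch decomposition s t u × Branch decomposition t s w)

  crossing-tree-edge-sorted : ∀ {s t u w} → InF T s t → u <F w → Crossing s t u w → InF T u w →
    (u , w) ≡ sortedPair s t
  crossing-tree-edge-sorted est u<w (inj₁ (b-t , b-s)) e =
    let s∈ , t∈ = crossing-tree-edge b-t b-s e in sortedPair-unique (InF-≢ G T est) s∈ t∈ u<w
  crossing-tree-edge-sorted est u<w (inj₂ (b-s , b-t)) e =
    let s∈ , t∈ = crossing-tree-edge b-t b-s (InF-sym G T e)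
    in sortedPair-unique (InF-≢ G T est) (swap s∈) (swap t∈) u<w

  crossing-path-through : ∀ {s t u w ps} → Crossing s t u w → PathFrom (InF T) u w ps → s ∈ ps
  crossing-path-through {s} crossing path with path-avoids? _≟F_ s path
  crossing-path-through _ _ | inj₁ s∈ps = s∈ps
  crossing-path-through (inj₁ (b-t , b-s)) _ | inj₂ w = ⊥-elim (crossing-separated b-t b-s w)
  crossing-path-through (inj₂ (b-s , b-t)) _ | inj₂ w = ⊥-elim (crossing-separated b-t b-s (reverseʷ (InF-sym G T) w))

  adhesion-bound : ∀ {l} → LfenTAtMost G T l →
    ∀ s t → InF T s t → CardAtMost (Adh decomposition s t) (l + 1)
  adhesion-bound {l} lfen s t est =
    let xs , len , cover = lfen s in
    sortedPair s t ∷ xs , ≤-trans (s≤s len) (≤-reflexive (+-comm 1 l)) , covered cover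
    where
    covered : ∀ {xs} → (∀ p → Eloc G T s p → p ∈ xs) → ∀ p → Adh decomposition s t p → p ∈ sortedPair s t ∷ xs
    covered cover (u , w) (u<w , euw , crossing) with sel T u w in in-T
    ... | true = here (crossing-tree-edge-sorted est u<w crossing in-T)
    ... | false = let ps , path = proj₁ spanning u w in
      there (cover (u , w) (u<w , euw , in-T , ps , path , crossing-path-through crossing (proj₁ path)))

  module Torso (t : Fin (suc n)) (f : Fin (suc n) → TV decomposition) (img : ImgSpec decomposition t f) where

    f-hub : f t ≡ inj₁ t
    f-hub with img t
    ... | inj₁ (_ , e) = e
    ... | inj₂ (t≢t , _) = ⊥-elim (t≢t refl)

    f-neighbour : ∀ {s} → InF T t s → f s ≡ inj₂ s
    f-neighbour {s} ts with img s
    ... | inj₁ (s≡t , _) = ⊥-elim (InF-≢ G T ts (sym s≡t))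
    ... | inj₂ (_ , _ , e , b) = trans e (cong inj₂ (unique-neighbour (proj₁ b) ts (branch⇒walk b) [ InF-≢ G T ts ]))

    f-same-branch : ∀ {u w} → Walk (InF T) (t ≢_) u w → f u ≡ f w
    f-same-branch {u} {w} W with img u | img w
    ... | inj₁ (u≡t , _) | _ = ⊥-elim (headʷ W (sym u≡t))
    ... | inj₂ _ | inj₁ (w≡t , _) = ⊥-elim (lastʷ W (sym w≡t))
    ... | inj₂ (_ , _ , eu , bu) | inj₂ (_ , _ , ew , bw) = trans eu (trans
      (cong inj₂ (unique-neighbour (proj₁ bu) (proj₁ bw) (branch⇒walk bu ++ʷ W) (branch⇒walk bw))) (sym ew))

    TorsoEdge : Fin (suc n) × Fin (suc n) → Set
    TorsoEdge (u , w) = u <F w × E G u w × f u ≢ f w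

    torso-cond : Fin (suc n) → Fin (suc n) → Bool
    torso-cond u w = isYes (toℕ u <? toℕ w) ∧ adj G u w ∧ not (isYes (_≟TV_ decomposition (f u) (f w)))

    torso-cond⁻ : ∀ u w → torso-cond u w ≡ true → TorsoEdge (u , w)
    torso-cond⁻ u w c with toℕ u <? toℕ w | _≟TV_ decomposition (f u) (f w) | adj G u w
    ... | yes u<w | no fu≢fw | true = u<w , refl , fu≢fw

    torso-cond⁺ : ∀ u w → TorsoEdge (u , w) → torso-cond u w ≡ true
    torso-cond⁺ u w (u<w , euw , fu≢fw) with toℕ u <? toℕ w | _≟TV_ decomposition (f u) (f w)
    ... | no u≮w | _ = ⊥-elim (u≮w u<w)
    ... | yes _ | yes fu≡fw = ⊥-elim (fu≢fw fu≡fw)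
    ... | yes _ | no _ rewrite euw = refl

    pairs : List (Fin (suc n) × Fin (suc n))
    pairs = cartesianProduct (allFin (suc n)) (allFin (suc n))

    torso-cond? : Decidable (λ p → uncurry torso-cond p ≡ true)
    torso-cond? p = uncurry torso-cond p ≟B true

    torso-edges : edges (Torso decomposition t f)
                ≡ map (λ p → f (proj₁ p) , f (proj₂ p)) (filter torso-cond? pairs)
    torso-edges = concatMap-if≡map-filter torso-cond (λ u w → f u , f w) (allFin (suc n)) (allFin (suc n))

    ∈-torso-edges : ∀ {u w} → TorsoEdge (u , w) → (f u , f w) ∈ edges (Torso decomposition t f)
    ∈-torso-edges {u} {w} edge = subst ((f u , f w) ∈_) (sym torso-edges)
      (∈-map⁺ _ (∈-filter⁺ torso-cond? (∈-cartesianProduct⁺ (∈-allFin u) (∈-allFin w)) (torso-cond⁺ u w edge)))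

    tree-torso-edge-at-hub : ∀ {u w} → TorsoEdge (u , w) → InF T u w → u ≡ t ⊎ w ≡ t
    tree-torso-edge-at-hub {u} {w} (_ , _ , fu≢fw) e with u ≟F t | w ≟F t
    ... | yes u≡t | _ = inj₁ u≡t
    ... | no _ | yes w≡t = inj₂ w≡t
    ... | no u≢t | no w≢t = ⊥-elim (fu≢fw (f-same-branch ((u≢t ∘ sym) ∷⟨ e ⟩ [ w≢t ∘ sym ])))

    far-end : Fin (suc n) × Fin (suc n) → Fin (suc n)
    far-end (u , w) with u ≟F t
    ... | yes _ = w
    ... | no _ = u

    tree-torso-edge-spoke : ∀ {u w} → TorsoEdge (u , w) → InF T u w →
      InF T t (far-end (u , w)) × (u , w) ≡ sortedPair t (far-end (u , w))
    tree-torso-edge-spoke {u} {w} edge@(u<w , _) e with u ≟F t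
    ... | yes refl = e , sortedPair-unique (InF-≢ G T e) (inj₁ refl) (inj₂ refl) u<w
    ... | no u≢t with tree-torso-edge-at-hub edge e
    ...   | inj₁ u≡t = ⊥-elim (u≢t u≡t)
    ...   | inj₂ refl = InF-sym G T e , sortedPair-unique (InF-≢ G T (InF-sym G T e)) (inj₂ refl) (inj₁ refl) u<w

    non-tree-torso-edge-Eloc : ∀ {u w} → TorsoEdge (u , w) → sel T u w ≡ false → Eloc G T t (u , w)
    non-tree-torso-edge-Eloc {u} {w} (u<w , euw , fu≢fw) ∉T with proj₁ spanning u w
    ... | ps , path with path-avoids? _≟F_ t (proj₁ path)
    ...   | inj₁ t∈ps = u<w , euw , ∉T , ps , path , t∈ps
    ...   | inj₂ W = ⊥-elim (fu≢fw (f-same-branch W))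

    TorsoX? : Decidable (TorsoX decomposition)
    TorsoX? (inj₁ _) = yes tt
    TorsoX? (inj₂ _) = no λ ()

    -- Only the branch vertices inj₂ s have spokes; the value at inj₁ v is never used.
    spoke : TV decomposition → TV decomposition × TV decomposition
    spoke (inj₁ v) = inj₁ v , inj₁ v
    spoke (inj₂ s) with toℕ t <? toℕ s
    ... | yes _ = inj₁ t , inj₂ s
    ... | no _ = inj₂ s , inj₁ t

    spoke-joins : ∀ {x} → ¬ TorsoX decomposition x → ThreeCenter.Joins (_≟TV_ decomposition) (spoke x) x (inj₁ t)
    spoke-joins {inj₁ _} ¬X = ⊥-elim (¬X tt)
    spoke-joins {inj₂ s} _ with toℕ t <? toℕ s
    ... | yes _ = inj₂ refl
    ... | no _ = inj₁ refl

    hub≢neighbour : ∀ {s} → InF T t s → f t ≢ f s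
    hub≢neighbour ts eq with trans (sym f-hub) (trans eq (f-neighbour ts))
    ... | ()

    spoke-∈-torso : ∀ {s} → InF T t s → spoke (inj₂ s) ∈ edges (Torso decomposition t f)
    spoke-∈-torso {s} ts with toℕ t <? toℕ s
    ... | yes t<s = subst (_∈ edges (Torso decomposition t f)) (cong₂ _,_ f-hub (f-neighbour ts))
                      (∈-torso-edges (t<s , sub T t s ts , hub≢neighbour ts))
    ... | no t≮s = subst (_∈ edges (Torso decomposition t f)) (cong₂ _,_ (f-neighbour ts) f-hub)
                      (∈-torso-edges (s<t , sub T s t (InF-sym G T ts) , hub≢neighbour ts ∘ sym))
      where
      s<t : s <F t
      s<t = ≤∧≢⇒< (≮⇒≥ t≮s) (λ s≡t → InF-≢ G T ts (toℕ-injective (sym s≡t)))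

    open Spokes (_≟TV_ decomposition) TorsoX? {hub = inj₁ t} tt spoke spoke-joins
    open ThreeCenter (_≟TV_ decomposition) using (ThreeCenterSize)

    torso-vertex : ∀ {x} → x ∈ verts (Torso decomposition t f) → x ≡ inj₁ t ⊎ Σ _ λ s → x ≡ inj₂ s × InF T t s
    torso-vertex x∈ with ∈-++⁻ (map inj₁ (filter (_≟F t) (allFin (suc n)))) x∈
    ... | inj₁ x∈₁ with ∈-map⁻ inj₁ x∈₁
    ...   | v , v∈ , refl = inj₁ (cong inj₁ (proj₂ (∈-filter⁻ (_≟F t) {xs = allFin (suc n)} v∈)))
    torso-vertex x∈ | inj₂ x∈₂ with ∈-map⁻ inj₂ x∈₂
    ...   | s , s∈ , refl = inj₂ (s , refl , proj₂ (∈-filter⁻ (λ s → sel T t s ≟B true) {xs = allFin (suc n)} s∈))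

    neighbour-∈-inner : ∀ {s} → InF T t s → inj₂ s ∈ inner (verts (Torso decomposition t f))
    neighbour-∈-inner {s} ts = ∈-filter⁺ (∁? TorsoX?)
      (∈-++⁺ʳ (map inj₁ (filter (_≟F t) (allFin (suc n))))
              (∈-map⁺ inj₂ (∈-filter⁺ (λ s → sel T t s ≟B true) (∈-allFin s) ts)))
      (λ ())

    torso-verts-unique : Unique (verts (Torso decomposition t f))
    torso-verts-unique = UniqueP.++⁺
      (UniqueP.map⁺ inj₁-injective (UniqueP.filter⁺ (_≟F t) (UniqueP.allFin⁺ _)))
      (UniqueP.map⁺ inj₂-injective (UniqueP.filter⁺ (λ s → sel T t s ≟B true) (UniqueP.allFin⁺ _)))
      disjoint
      where
      disjoint : ∀ {x} → ¬ (x ∈ map inj₁ (filter (_≟F t) (allFin (suc n)))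
                           × x ∈ map inj₂ (filter (λ s → sel T t s ≟B true) (allFin (suc n))))
      disjoint (x∈₁ , x∈₂) with ∈-map⁻ inj₁ x∈₁ | ∈-map⁻ inj₂ x∈₂
      ... | _ , _ , refl | _ , _ , ()

    torso-pairs : List (Fin (suc n) × Fin (suc n))
    torso-pairs = filter torso-cond? pairs

    in-T? : Decidable (λ p → InF T (proj₁ p) (proj₂ p))
    in-T? p = sel T (proj₁ p) (proj₂ p) ≟B true

    unique-torso-pairs : Unique torso-pairs
    unique-torso-pairs = UniqueP.filter⁺ torso-cond? (UniqueP.cartesianProduct⁺ (UniqueP.allFin⁺ _) (UniqueP.allFin⁺ _))

    ∈-torso-pairs⁻ : ∀ {p} → p ∈ torso-pairs → TorsoEdge p
    ∈-torso-pairs⁻ {u , w} p∈ = torso-cond⁻ u w (proj₂ (∈-filter⁻ torso-cond? {xs = pairs} p∈))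

    tree-torso-pairs-≤ : length (filter in-T? torso-pairs) ≤ length (inner (verts (Torso decomposition t f)))
    tree-torso-pairs-≤ = length-≤-injection (inj₂ ∘ far-end) (UniqueP.filter⁺ in-T? unique-torso-pairs)
      (λ p∈ q∈ eq → trans (proj₂ (spoke-of p∈)) (trans (cong (sortedPair t) (inj₂-injective eq)) (sym (proj₂ (spoke-of q∈)))))
      (λ p∈ → neighbour-∈-inner (proj₁ (spoke-of p∈)))
      where
      spoke-of : ∀ {p} → p ∈ filter in-T? torso-pairs → InF T t (far-end p) × p ≡ sortedPair t (far-end p)
      spoke-of p∈ = let p∈′ , in-T = ∈-filter⁻ in-T? {xs = torso-pairs} p∈
                    in tree-torso-edge-spoke (∈-torso-pairs⁻ p∈′) in-T

    non-tree-torso-pairs-≤ : ∀ {l} → LfenTAtMost G T l → length (filter (∁? in-T?) torso-pairs) ≤ l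
    non-tree-torso-pairs-≤ lfen =
      let xs , len , cover = lfen t in
      ≤-trans (length-≤-⊆ (UniqueP.filter⁺ (∁? in-T?) unique-torso-pairs) (λ {p} p∈ →
        let p∈′ , ∉T = ∈-filter⁻ (∁? in-T?) {xs = torso-pairs} p∈
        in cover p (non-tree-torso-edge-Eloc (∈-torso-pairs⁻ p∈′) (¬-not ∉T)))) len

    torso-few-edges : ∀ {l} → LfenTAtMost G T l →
      length (edges (Torso decomposition t f)) ≤ length (inner (verts (Torso decomposition t f))) + l
    torso-few-edges {l} lfen = begin
      length (edges (Torso decomposition t f))          ≡⟨ cong length torso-edges ⟩
      length (map _ torso-pairs)                        ≡⟨ length-map _ torso-pairs ⟩
      length torso-pairs                                ≡⟨ length-filter-∁ in-T? torso-pairs ⟨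
      length (filter in-T? torso-pairs) + length (filter (∁? in-T?) torso-pairs)
                                                        ≤⟨ +-mono-≤ tree-torso-pairs-≤ (non-tree-torso-pairs-≤ lfen) ⟩
      length (inner (verts (Torso decomposition t f))) + l ∎
      where open ≤-Reasoning

    initial-invariant : ∀ {l} → LfenTAtMost G T l → Invariant l (Torso decomposition t f)
    initial-invariant lfen = record
      { unique    = torso-verts-unique
      ; terminals = terminals′
      ; spokes    = spokes′
      ; few-edges = torso-few-edges lfen
      }
      where
      terminals′ : ∀ {x} → x ∈ verts (Torso decomposition t f) → TorsoX decomposition x → x ≡ inj₁ t
      terminals′ x∈ X with torso-vertex x∈
      ... | inj₁ x≡hub = x≡hub
      ... | inj₂ (_ , refl , _) = ⊥-elim X
      spokes′ : ∀ {x} → x ∈ verts (Torso decomposition t f) → ¬ TorsoX decomposition x →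
        spoke x ∈ edges (Torso decomposition t f)
      spokes′ x∈ ¬X with torso-vertex x∈
      ... | inj₁ refl = ⊥-elim (¬X tt)
      ... | inj₂ (_ , refl , ts) = spoke-∈-torso ts

    torso-size : ∀ {l} → LfenTAtMost G T l →
      ∀ c → ThreeCenterSize (TorsoX decomposition) (Torso decomposition t f) c → c ≤ l + 1
    torso-size lfen _ (_ , steps , irreducible , refl) =
      irreducible-size (steps-preserve steps (initial-invariant lfen)) irreducible

  width-bound : ∀ {l} → LfenTAtMost G T l → WidthAtMost decomposition (l + 1)
  width-bound lfen = adhesion-bound lfen , λ t f img → Torso.torso-size t f img lfen

proposition1 : ∀ {n : ℕ} (G : Graph (suc n)) → Connected (E G) →
    ∀ (t l f : ℕ) → IsTcw G t → IsLfen G l → IsFen G f →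
    (t ≤ l + 1) × (l ≤ f)
proposition1 G connected t l f (_ , tcw-minimal) ((T , spanning , lfen-T) , lfen-minimal) ((F , feedback , F≤f) , _) =
  let T′ , spanning′ , lfen-T′ = lfen-bounded-by-feedback connected F feedback F≤f
  in tcw-minimal decomposition (l + 1) (width-bound lfen-T) , lfen-minimal T′ f spanning′ lfen-T′
  where open SpanningTreeDecomposition G T spanning using (decomposition; width-bound)
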